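{- Let $k\ge 1$, $n=4k$, let $j\ge 0$ be an integer which is odd if $k$ is even and even if $k$ is odd, and let $t$ be an odd integer. Let $\zeta$ be a primitive element of $\mathbb{F}_{3^{2k}}$ and $b=\zeta^{t(3^k+1)/2}\in\mathbb{F}_{3^{2k}}^*$. Let $c\in\mathbb{F}_{3^n}^*$. If $c\in\mathbb{F}_{3^{2k}}^*$, or if $c\notin\mathbb{F}_{3^k}$ and $\mathrm{Tr}^n_k(bc)\neq 0$, then the function $$d\mapsto \mathrm{Tr}_n\big((b c^{3^j}+b^{3^{ -j}}c^{3^{ -j}})d\big),\qquad d\in\mathbb{F}_{3^n},$$ is not identically zero.
   Context: $\mathrm{Tr}^n_k(x)=\sum_{i=0}^{n/k-1}x^{3^{ik}}$ is the trace from $\mathbb{F}_{3^n}$ to $\mathbb{F}_{3^k}$ and $\mathrm{Tr}_n=\mathrm{Tr}^n_1$. For $z\in\mathbb{F}_{3^n}$, $z^{3^{ -j}}$ denotes the inverse of the Frobenius power, i.e. $z^{3^{ -j}}=z^{3^{n-j}}$ (the unique $w$ with $w^{3^j}=z$). -}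

module Defs where

open import Level using (0ℓ)
open import Algebra.Bundles using (CommutativeRing)
open import Data.Nat using (ℕ; zero; suc; NonZero)
import Data.Nat as N
open import Data.Product using (_×_)
open import Data.Integer using (ℤ; +_; -[1+_])
open import Data.Fin using (Fin)
open import Data.Product using (∃)
open import Relation.Binary.PropositionalEquality using (_≡_)

-- A finite field with exactly 3^n elements (hence of characteristic 3):
-- a commutative ring (with setoid equality ≈) in which 0 ≉ 1 and every
-- nonzero element has a multiplicative inverse, together with a bijection
-- (up to ≈) between Fin (3^n) and the carrier.
record GF3 (n : ℕ) : Set₁ where
  field
    R : CommutativeRing 0ℓ 0ℓ
  open CommutativeRing R
  field
    _⁻¹       : Carrier → Carrier
    inverseʳ  : ∀ x → x ≉ 0# → (x * (x ⁻¹)) ≈ 1#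
    0≉1       : 0# ≉ 1#
    enum      : Fin (3 N.^ n) → Carrier
    enum-surj : ∀ x → ∃ λ i → enum i ≈ x
    enum-inj  : ∀ i j → enum i ≈ enum j → i ≡ j
  open CommutativeRing R public

module Ops {n : ℕ} (F : GF3 n) where
  open GF3 F

  infixr 8 _^ᶠ_ _^ᶻ_

  _^ᶠ_ : Carrier → ℕ → Carrier
  x ^ᶠ zero  = 1#
  x ^ᶠ suc m = x * (x ^ᶠ m)

  -- integer powers (negative exponents via the inverse; used for nonzero x)
  _^ᶻ_ : Carrier → ℤ → Carrier
  x ^ᶻ (+ m)     = x ^ᶠ m
  x ^ᶻ -[1+ m ]  = (x ⁻¹) ^ᶠ suc m

  sumTo : ℕ → (ℕ → Carrier) → Carrier
  sumTo zero    f = 0#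
  sumTo (suc m) f = sumTo m f + f m

  TrRel : (k : ℕ) → .{{NonZero k}} → Carrier → Carrier
  TrRel k x = sumTo (n N./ k) (λ i → x ^ᶠ (3 N.^ (i N.* k)))

  Tr : Carrier → Carrier
  Tr x = TrRel 1 x

  -- inverse Frobenius z^{3^{-j}} = z^{3^{nj - j}} (the unique w with w^{3^j} = z)
  frobInv : ℕ → Carrier → Carrier
  frobInv j z = z ^ᶠ (3 N.^ (n N.* j N.∸ j))

  InSub : ℕ → Carrier → Set
  InSub e x = x ^ᶠ (3 N.^ e) ≈ x

  IsPrimitiveSub : ℕ → Carrier → Set
  IsPrimitiveSub e ζ =
    InSub e ζ × (ζ ≉ 0#) × (∀ m → 1 N.≤ m → m N.< (3 N.^ e N.∸ 1) → ζ ^ᶠ m ≉ 1#)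

-- The function d ↦ Tr(a d) vanishes identically only for a = 0: Tr is a polynomial of
-- degree 3^(n-1) < 3^n, so it cannot vanish on the whole field.  So it suffices to show
-- that a = b c^q + b^(3^-j) c^(3^-j), q = 3^j, is nonzero.  Raising a = 0 to the q-th
-- power gives b^(q-1) c^(q²-1) = -1.  Write 3^(2k) = 1 + 8g: then ζ has order 8g,
-- ζ^(4g) = -1 and 3^(4k) - 1 = 16g(4g+1).  Raising to a power P with
-- 3^(4k) - 1 ∣ (q²-1) P removes c (Fermat) and leaves ζ^(±th(q-1)P) = (-1)^P.  Both when
-- k is even and j odd and when k is odd and j even, the exponent of ζ (shifted by 4g when
-- P is odd) is 4g times an odd number, which the order 8g cannot divide.
module Submission where

open import Defs
open import Data.Nat using (ℕ; NonZero; zero; suc; _≤_; _<_; _∸_)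
import Data.Nat as N
import Data.Integer as Z
open import Data.Nat.Divisibility using (_∣_; _∣?_; divides; _∣0; m∣m*n; m%n≡0⇒n∣m; *-cancelˡ-∣)
open import Data.Integer using (ℤ; +_; -[1+_])
open import Data.Integer.Divisibility using () renaming (_∣_ to _∣ᶻ_)
open import Data.Product using (_×_; _,_; proj₁; proj₂; ∃)
open import Data.Sum using (_⊎_; inj₁; inj₂; [_,_]′)
open import Relation.Nullary using (¬_; yes; no; does; contradiction)

import Data.Nat.Properties as ℕₚ
import Data.Integer.Properties as ℤₚ
open import Data.Nat.DivMod using (m≡m%n+[m/n]*n; m%n<n; n/1≡n; m*n/n≡m)
open import Data.Nat.Primality using (euclidsLemma; prime[2])
open import Data.Nat.Tactic.RingSolver using (solve-∀)
open import Data.Fin as Fin using (Fin)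
import Data.Fin.Properties as Finₚ
open import Data.Fin.Permutation using (Permutation; permutation)
open import Data.Bool using (if_then_else_)
open import Data.Empty using (⊥)
open import Data.List using (List; []; _∷_; length)
open import Data.List.Relation.Unary.All using (All; []; _∷_)
open import Data.Vec.Functional using (replicate; removeAt)
open import Function using (_∘_; Injective)
open import Relation.Binary using (Decidable)
open import Relation.Nullary.Decidable using (map′; dec-true; dec-false; decidable-stable)
open import Relation.Binary.PropositionalEquality as ≡ using (_≡_; _≢_)
import Algebra.Properties.CommutativeMonoid.Sum as CommutativeMonoidSum
import Algebra.Solver.Ring.NaturalCoefficients.Default

even-or-odd : ∀ m → 2 ∣ m ⊎ ∃ λ x → m ≡ 1 N.+ 2 N.* x
even-or-odd zero    = inj₁ (2 ∣0)
even-or-odd (suc m) with even-or-odd m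
... | inj₁ (divides q m≡q*2) = inj₂ (q , ≡.cong suc (≡.trans m≡q*2 (ℕₚ.*-comm q 2)))
... | inj₂ (x , m≡1+2x)       = inj₁ (divides (suc x) (≡.trans (≡.cong suc m≡1+2x) (2+2x≡[1+x]*2 x)))
  where
  2+2x≡[1+x]*2 : ∀ x → 2 N.+ 2 N.* x ≡ suc x N.* 2
  2+2x≡[1+x]*2 = solve-∀

odd⇒≡1+2* : ∀ {m} → ¬ 2 ∣ m → ∃ λ x → m ≡ 1 N.+ 2 N.* x
odd⇒≡1+2* {m} m-odd with even-or-odd m
... | inj₁ m-even = contradiction m-even m-odd
... | inj₂ m≡1+2x = m≡1+2x

1+2*-odd : ∀ x → ¬ 2 ∣ 1 N.+ 2 N.* x
1+2*-odd x (divides q 1+2x≡q*2) = ℕₚ.even≢odd q x (≡.sym (≡.trans 1+2x≡q*2 (ℕₚ.*-comm q 2)))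

odd*odd : ∀ {m m′} → ¬ 2 ∣ m → ¬ 2 ∣ m′ → ¬ 2 ∣ m N.* m′
odd*odd {m} {m′} m-odd m′-odd 2∣mm′ = [ m-odd , m′-odd ]′ (euclidsLemma m m′ prime[2] 2∣mm′)

3^-odd : ∀ j → ¬ 2 ∣ 3 N.^ j
3^-odd zero    = 1+2*-odd 0
3^-odd (suc j) = odd*odd (1+2*-odd 1) (3^-odd j)

pow-≡1-mod : ∀ d x m → ∃ λ y → (1 N.+ d N.* x) N.^ m ≡ 1 N.+ d N.* y
pow-≡1-mod d x zero    = 0 , ≡.cong suc (≡.sym (ℕₚ.*-zeroʳ d))
pow-≡1-mod d x (suc m) with pow-≡1-mod d x m
... | y , eq = x N.+ y N.+ d N.* x N.* y , ≡.trans (≡.cong ((1 N.+ d N.* x) N.*_) eq) (product d x y)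
  where
  product : ∀ d x y → (1 N.+ d N.* x) N.* (1 N.+ d N.* y) ≡ 1 N.+ d N.* (x N.+ y N.+ d N.* x N.* y)
  product = solve-∀

3^[2m]≡1+8* : ∀ m → ∃ λ y → 3 N.^ (2 N.* m) ≡ 1 N.+ 8 N.* y
3^[2m]≡1+8* m with pow-≡1-mod 8 1 m
... | y , eq = y , ≡.trans (≡.sym (ℕₚ.^-*-assoc 3 2 m)) eq

3^[4m]≡1+16* : ∀ m → ∃ λ y → 3 N.^ (4 N.* m) ≡ 1 N.+ 16 N.* y
3^[4m]≡1+16* m with pow-≡1-mod 16 5 m
... | y , eq = y , ≡.trans (≡.sym (ℕₚ.^-*-assoc 3 4 m)) eq

3^j*3^j≡3^[2j] : ∀ j → 3 N.^ j N.* 3 N.^ j ≡ 3 N.^ (2 N.* j)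
3^j*3^j≡3^[2j] j = ≡.trans (≡.sym (ℕₚ.^-distribˡ-+-* 3 j j))
                           (≡.cong (λ e → 3 N.^ (j N.+ e)) (≡.sym (ℕₚ.+-identityʳ j)))

[3^k+1]/2≡odd : ∀ {k x} → 3 N.^ k ≡ 1 N.+ 8 N.* x → (3 N.^ k N.+ 1) N./ 2 ≡ 1 N.+ 2 N.* (2 N.* x)
[3^k+1]/2≡odd {k} {x} 3^k≡1+8x = ≡.trans (≡.cong (λ m → (m N.+ 1) N./ 2) 3^k≡1+8x)
  (≡.trans (≡.cong (N._/ 2) (halve x)) (m*n/n≡m (1 N.+ 2 N.* (2 N.* x)) 2))
  where
  halve : ∀ x → 1 N.+ 8 N.* x N.+ 1 ≡ (1 N.+ 2 N.* (2 N.* x)) N.* 2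
  halve = solve-∀

module FiniteField {n : ℕ} (F : GF3 n) where
  open GF3 F hiding (zero)
  open Ops F
  open import Algebra.Properties.Ring ring using (-1*x≈-x; -‿involutive)
  open import Algebra.Properties.Group +-group using (x∙y⁻¹≈ε⇒x≈y; ∙-cancelˡ)
  open import Algebra.Properties.CommutativeSemigroup *-commutativeSemigroup using (interchange)
  open import Algebra.Properties.CommutativeSemiring.Exp commutativeSemiring
    using (_^_; ^-congˡ; ^-homo-*; ^-assocʳ; ^-distrib-*)
  open import Relation.Binary.Reasoning.Setoid setoid
  module Π = CommutativeMonoidSum *-commutativeMonoid

  ^ᶠ≡^ : ∀ x m → x ^ᶠ m ≡ x ^ m
  ^ᶠ≡^ x zero    = ≡.refl
  ^ᶠ≡^ x (suc m) = ≡.cong (x *_) (^ᶠ≡^ x m)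

  ^ᶠ-congˡ : ∀ m {x y} → x ≈ y → x ^ᶠ m ≈ y ^ᶠ m
  ^ᶠ-congˡ m {x} {y} x≈y rewrite ^ᶠ≡^ x m | ^ᶠ≡^ y m = ^-congˡ m x≈y

  ^ᶠ-congʳ : ∀ x {m m′} → m ≡ m′ → x ^ᶠ m ≈ x ^ᶠ m′
  ^ᶠ-congʳ x ≡.refl = refl

  ^ᶠ-homo-* : ∀ x m m′ → x ^ᶠ (m N.+ m′) ≈ x ^ᶠ m * x ^ᶠ m′
  ^ᶠ-homo-* x m m′ rewrite ^ᶠ≡^ x (m N.+ m′) | ^ᶠ≡^ x m | ^ᶠ≡^ x m′ = ^-homo-* x m m′

  ^ᶠ-assocʳ : ∀ x m m′ → (x ^ᶠ m) ^ᶠ m′ ≈ x ^ᶠ (m N.* m′)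
  ^ᶠ-assocʳ x m m′ rewrite ^ᶠ≡^ (x ^ᶠ m) m′ | ^ᶠ≡^ x m | ^ᶠ≡^ x (m N.* m′) = ^-assocʳ x m m′

  ^ᶠ-distrib-* : ∀ x y m → (x * y) ^ᶠ m ≈ x ^ᶠ m * y ^ᶠ m
  ^ᶠ-distrib-* x y m rewrite ^ᶠ≡^ (x * y) m | ^ᶠ≡^ x m | ^ᶠ≡^ y m = ^-distrib-* x y m

  1^ᶠ : ∀ m → 1# ^ᶠ m ≈ 1#
  1^ᶠ zero    = refl
  1^ᶠ (suc m) = trans (*-identityˡ (1# ^ᶠ m)) (1^ᶠ m)

  card : ℕ
  card = 3 N.^ n

  instance
    card≢0 : NonZero card
    card≢0 = ℕₚ.m^n≢0 3 n

  index : Carrier → Fin card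
  index x = proj₁ (enum-surj x)

  enum-index : ∀ x → enum (index x) ≈ x
  enum-index x = proj₂ (enum-surj x)

  _≟_ : Decidable _≈_
  x ≟ y = map′ from to (index x Finₚ.≟ index y)
    where
    from : index x ≡ index y → x ≈ y
    from eq = trans (sym (enum-index x)) (trans (reflexive (≡.cong enum eq)) (enum-index y))
    to : x ≈ y → index x ≡ index y
    to x≈y = enum-inj _ _ (trans (enum-index x) (trans x≈y (sym (enum-index y))))

  ≈-stable : ∀ {x y} → ¬ (x ≉ y) → x ≈ y
  ≈-stable {x} {y} = decidable-stable (x ≟ y)

  ifZero : Carrier → Carrier → Carrier → Carrier
  ifZero x y z = if does (x ≟ 0#) then y else z

  ifZero-≈0 : ∀ {x} y z → x ≈ 0# → ifZero x y z ≡ y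
  ifZero-≈0 {x} y z x≈0 rewrite dec-true (x ≟ 0#) x≈0 = ≡.refl

  ifZero-≉0 : ∀ {x} y z → x ≉ 0# → ifZero x y z ≡ z
  ifZero-≉0 {x} y z x≉0 rewrite dec-false (x ≟ 0#) x≉0 = ≡.refl

  x⁻¹*x≈1 : ∀ {x} → x ≉ 0# → x ⁻¹ * x ≈ 1#
  x⁻¹*x≈1 {x} x≉0 = trans (*-comm (x ⁻¹) x) (inverseʳ x x≉0)

  x*[x⁻¹*y]≈y : ∀ {x} → x ≉ 0# → ∀ y → x * (x ⁻¹ * y) ≈ y
  x*[x⁻¹*y]≈y {x} x≉0 y = trans (sym (*-assoc _ _ _)) (trans (*-congʳ (inverseʳ x x≉0)) (*-identityˡ y))

  x⁻¹*[x*y]≈y : ∀ {x} → x ≉ 0# → ∀ y → x ⁻¹ * (x * y) ≈ y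
  x⁻¹*[x*y]≈y {x} x≉0 y = trans (sym (*-assoc _ _ _)) (trans (*-congʳ (x⁻¹*x≈1 x≉0)) (*-identityˡ y))

  *-cancelˡ : ∀ {x y z} → x ≉ 0# → x * y ≈ x * z → y ≈ z
  *-cancelˡ {x} {y} {z} x≉0 xy≈xz = begin
    y               ≈⟨ x⁻¹*[x*y]≈y x≉0 y ⟨
    x ⁻¹ * (x * y)  ≈⟨ *-congˡ xy≈xz ⟩
    x ⁻¹ * (x * z)  ≈⟨ x⁻¹*[x*y]≈y x≉0 z ⟩
    z               ∎

  *-≉0 : ∀ {x y} → x ≉ 0# → y ≉ 0# → x * y ≉ 0#
  *-≉0 {x} x≉0 y≉0 xy≈0 = y≉0 (*-cancelˡ x≉0 (trans xy≈0 (sym (zeroʳ x))))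

  ^ᶠ-≉0 : ∀ {x} m → x ≉ 0# → x ^ᶠ m ≉ 0#
  ^ᶠ-≉0 zero    _   1≈0 = 0≉1 (sym 1≈0)
  ^ᶠ-≉0 (suc m) x≉0     = *-≉0 x≉0 (^ᶠ-≉0 m x≉0)

  x⁻¹≉0 : ∀ {x} → x ≉ 0# → x ⁻¹ ≉ 0#
  x⁻¹≉0 x≉0 x⁻¹≈0 = 0≉1 (trans (sym (zeroˡ _)) (trans (*-congʳ (sym x⁻¹≈0)) (x⁻¹*x≈1 x≉0)))

  ^ᶻ-≉0 : ∀ {x} i → x ≉ 0# → x ^ᶻ i ≉ 0#
  ^ᶻ-≉0 (+ m)    x≉0 = ^ᶠ-≉0 m x≉0
  ^ᶻ-≉0 -[1+ m ] x≉0 = ^ᶠ-≉0 (suc m) (x⁻¹≉0 x≉0)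

  x+y≈0⇒x≈-y : ∀ {x y} → x + y ≈ 0# → x ≈ - y
  x+y≈0⇒x≈-y {x} {y} x+y≈0 = x∙y⁻¹≈ε⇒x≈y x (- y) (trans (+-congˡ (-‿involutive y)) x+y≈0)

  x*x≈1⇒x≈-1 : ∀ {x} → x * x ≈ 1# → x ≉ 1# → x ≈ - 1#
  x*x≈1⇒x≈-1 {x} x²≈1 x≉1 = ≈-stable λ x≉-1 → x≉1 (*-cancelˡ (x≉-1 ∘ x+y≈0⇒x≈-y) (begin
    (x + 1#) * x    ≈⟨ distribʳ x x 1# ⟩
    x * x + 1# * x  ≈⟨ +-cong x²≈1 (*-identityˡ x) ⟩
    1# + x          ≈⟨ +-comm 1# x ⟩
    x + 1#          ≈⟨ *-identityʳ _ ⟨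
    (x + 1#) * 1#   ∎))

  -1*-1≈1 : - 1# * - 1# ≈ 1#
  -1*-1≈1 = trans (-1*x≈-x (- 1#)) (-‿involutive 1#)

  -1^even : ∀ {m} → 2 ∣ m → (- 1#) ^ᶠ m ≈ 1#
  -1^even {m} (divides q m≡q*2) = begin
    (- 1#) ^ᶠ m          ≡⟨ ≡.cong ((- 1#) ^ᶠ_) (≡.trans m≡q*2 (ℕₚ.*-comm q 2)) ⟩
    (- 1#) ^ᶠ (2 N.* q)  ≈⟨ ^ᶠ-assocʳ (- 1#) 2 q ⟨
    ((- 1#) ^ᶠ 2) ^ᶠ q   ≈⟨ ^ᶠ-congˡ q (trans (*-congˡ (*-identityʳ (- 1#))) -1*-1≈1) ⟩
    1# ^ᶠ q              ≈⟨ 1^ᶠ q ⟩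
    1#                   ∎

  -1^odd : ∀ {m} → ¬ 2 ∣ m → (- 1#) ^ᶠ m ≈ - 1#
  -1^odd m-odd with odd⇒≡1+2* m-odd
  ... | x , ≡.refl = trans (*-congˡ (-1^even (m∣m*n x))) (*-identityʳ (- 1#))

  -1^m*-1^m≈1 : ∀ m → (- 1#) ^ᶠ m * (- 1#) ^ᶠ m ≈ 1#
  -1^m*-1^m≈1 m = trans (sym (^ᶠ-distrib-* (- 1#) (- 1#) m)) (trans (^ᶠ-congˡ m -1*-1≈1) (1^ᶠ m))

  x^m*x⁻¹^m≈1 : ∀ {x} m → x ≉ 0# → x ^ᶠ m * (x ⁻¹) ^ᶠ m ≈ 1#
  x^m*x⁻¹^m≈1 {x} m x≉0 =
    trans (sym (^ᶠ-distrib-* x (x ⁻¹) m)) (trans (^ᶠ-congˡ m (inverseʳ x x≉0)) (1^ᶠ m))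

  x⁻¹^m≈ε⇒x^m≈ε : ∀ {x ε} m → x ≉ 0# → ε * ε ≈ 1# → (x ⁻¹) ^ᶠ m ≈ ε → x ^ᶠ m ≈ ε
  x⁻¹^m≈ε⇒x^m≈ε {x} {ε} m x≉0 ε²≈1 x⁻ᵐ≈ε = begin
    x ^ᶠ m                    ≈⟨ *-identityʳ _ ⟨
    x ^ᶠ m * 1#               ≈⟨ *-congˡ ε²≈1 ⟨
    x ^ᶠ m * (ε * ε)          ≈⟨ *-assoc _ _ _ ⟨
    x ^ᶠ m * ε * ε            ≈⟨ *-congʳ (*-congˡ x⁻ᵐ≈ε) ⟨
    x ^ᶠ m * (x ⁻¹) ^ᶠ m * ε  ≈⟨ *-congʳ (x^m*x⁻¹^m≈1 m x≉0) ⟩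
    1# * ε                    ≈⟨ *-identityˡ ε ⟩
    ε                         ∎

  ^ᶻ-to-^ᶠ : ∀ x t h → x ^ᶻ (t Z.* + h) ≈ x ^ᶠ (Z.∣ t ∣ N.* h)
                     ⊎ x ^ᶻ (t Z.* + h) ≈ (x ⁻¹) ^ᶠ (Z.∣ t ∣ N.* h)
  ^ᶻ-to-^ᶠ x t        zero    = inj₁ (reflexive (≡.trans (≡.cong (x ^ᶻ_) (ℤₚ.*-zeroʳ t))
                                                          (≡.cong (x ^ᶠ_) (≡.sym (ℕₚ.*-zeroʳ Z.∣ t ∣)))))
  ^ᶻ-to-^ᶠ x (+ m)    (suc h) = inj₁ (reflexive (≡.cong (x ^ᶻ_) (≡.sym (ℤₚ.pos-* m (suc h)))))
  ^ᶻ-to-^ᶠ x -[1+ m ] (suc h) = inj₂ refl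

  ^ᶻ-to-^ᶠ-≈ε : ∀ {x ε} t h m → x ≉ 0# → ε * ε ≈ 1# →
                (x ^ᶻ (t Z.* + h)) ^ᶠ m ≈ ε → x ^ᶠ (Z.∣ t ∣ N.* h N.* m) ≈ ε
  ^ᶻ-to-^ᶠ-≈ε {x} t h m x≉0 ε²≈1 pow≈ε with ^ᶻ-to-^ᶠ x t h
  ... | inj₁ eq = trans (sym (^ᶠ-assocʳ x (Z.∣ t ∣ N.* h) m)) (trans (^ᶠ-congˡ m (sym eq)) pow≈ε)
  ... | inj₂ eq = x⁻¹^m≈ε⇒x^m≈ε (Z.∣ t ∣ N.* h N.* m) x≉0 ε²≈1
    (trans (sym (^ᶠ-assocʳ (x ⁻¹) (Z.∣ t ∣ N.* h) m)) (trans (^ᶠ-congˡ m (sym eq)) pow≈ε))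

  pow≈1⇒order∣ : ∀ {x d} .{{_ : NonZero d}} → x ^ᶠ d ≈ 1# →
                 (∀ m → 1 ≤ m → m < d → x ^ᶠ m ≉ 1#) → ∀ m → x ^ᶠ m ≈ 1# → d ∣ m
  pow≈1⇒order∣ {x} {d} x^d≈1 minimal m x^m≈1 = m%n≡0⇒n∣m m d (remainder≡0 (m N.% d) ≡.refl)
    where
    x^rem≈1 : x ^ᶠ (m N.% d) ≈ 1#
    x^rem≈1 = begin
      x ^ᶠ (m N.% d)                          ≈⟨ *-identityʳ _ ⟨
      x ^ᶠ (m N.% d) * 1#                     ≈⟨ *-congˡ (trans (^ᶠ-congˡ (m N./ d) x^d≈1) (1^ᶠ (m N./ d))) ⟨
      x ^ᶠ (m N.% d) * (x ^ᶠ d) ^ᶠ (m N./ d)  ≈⟨ *-congˡ (^ᶠ-assocʳ x d (m N./ d)) ⟩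
      x ^ᶠ (m N.% d) * x ^ᶠ (d N.* (m N./ d)) ≡⟨ ≡.cong (λ e → x ^ᶠ (m N.% d) * x ^ᶠ e) (ℕₚ.*-comm d (m N./ d)) ⟩
      x ^ᶠ (m N.% d) * x ^ᶠ (m N./ d N.* d)   ≈⟨ ^ᶠ-homo-* x (m N.% d) (m N./ d N.* d) ⟨
      x ^ᶠ (m N.% d N.+ m N./ d N.* d)        ≈⟨ ^ᶠ-congʳ x (m≡m%n+[m/n]*n m d) ⟨
      x ^ᶠ m                                  ≈⟨ x^m≈1 ⟩
      1#                                      ∎
    remainder≡0 : ∀ r → m N.% d ≡ r → r ≡ 0
    remainder≡0 zero    _  = ≡.refl
    remainder≡0 (suc r) eq = contradiction (trans (^ᶠ-congʳ x (≡.sym eq)) x^rem≈1)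
      (minimal (suc r) (N.s≤s N.z≤n) (≡.subst (_< d) eq (m%n<n m d)))

  carrierPermutation : (f g : Carrier → Carrier) →
                       (∀ {x y} → x ≈ y → f x ≈ f y) → (∀ {x y} → x ≈ y → g x ≈ g y) →
                       (∀ x → f (g x) ≈ x) → (∀ x → g (f x) ≈ x) → Permutation card card
  carrierPermutation f g f-cong g-cong fg≈id gf≈id =
    permutation (index ∘ f ∘ enum) (index ∘ g ∘ enum) (inverse f-cong fg≈id) (inverse g-cong gf≈id)
    where
    inverse : ∀ {f g : Carrier → Carrier} → (∀ {x y} → x ≈ y → f x ≈ f y) → (∀ x → f (g x) ≈ x) →
              ∀ i → index (f (enum (index (g (enum i))))) ≡ i
    inverse f-cong fg≈id i =
      enum-inj _ _ (trans (enum-index _) (trans (f-cong (enum-index _)) (fg≈id (enum i))))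

  prod-≉0 : ∀ {m} (v : Fin m → Carrier) → (∀ i → v i ≉ 0#) → Π.sum v ≉ 0#
  prod-≉0 {zero}  v _   1≈0 = 0≉1 (sym 1≈0)
  prod-≉0 {suc m} v v≉0     = *-≉0 (v≉0 Fin.zero) (prod-≉0 (v ∘ Fin.suc) (v≉0 ∘ Fin.suc))

  prod-all-but-one : ∀ {m} (i₀ : Fin m) (a : Carrier) (v : Fin m → Carrier) →
                     v i₀ ≈ 1# → (∀ i → i ≢ i₀ → v i ≈ a) → Π.sum v ≈ a ^ᶠ (m ∸ 1)
  prod-all-but-one {suc m} i₀ a v vᵢ₀≈1 v≈a = begin
    Π.sum v                       ≈⟨ Π.sum-remove v ⟩
    v i₀ * Π.sum (removeAt v i₀)  ≈⟨ *-cong vᵢ₀≈1 (Π.sum-cong-≋ (λ j → v≈a _ (Finₚ.punchInᵢ≢i i₀ j))) ⟩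
    1# * Π.sum (replicate m a)    ≈⟨ *-identityˡ _ ⟩
    Π.sum (replicate m a)         ≈⟨ Π.sum-replicate m ⟩
    a ^ m                         ≡⟨ ^ᶠ≡^ a m ⟨
    a ^ᶠ m                        ∎

  fermat : ∀ {a} → a ≉ 0# → a ^ᶠ (card ∸ 1) ≈ 1#
  fermat {a} a≉0 = sym (*-cancelˡ (prod-≉0 (w ∘ enum) (w≉0 ∘ enum)) (begin
    Π.sum (w ∘ enum) * 1#                        ≈⟨ *-identityʳ _ ⟩
    Π.sum (w ∘ enum)                             ≈⟨ Π.sum-permute (w ∘ enum) scaling ⟩
    Π.sum (λ i → w (enum (index (a * enum i))))  ≈⟨ Π.sum-cong-≋ (λ i → w-scale (enum-index (a * enum i))) ⟩
    Π.sum (λ i → u (enum i) * w (enum i))        ≈⟨ Π.∑-distrib-+ (u ∘ enum) (w ∘ enum) ⟩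
    Π.sum (u ∘ enum) * Π.sum (w ∘ enum)          ≈⟨ *-congʳ Πu≈a^[card-1] ⟩
    a ^ᶠ (card ∸ 1) * Π.sum (w ∘ enum)           ≈⟨ *-comm _ _ ⟩
    Π.sum (w ∘ enum) * a ^ᶠ (card ∸ 1)           ∎))
    where
    -- w replaces 0 by 1, so Π w is the product of the nonzero elements; multiplying the
    -- field by a permutes it and multiplies each nonzero factor by a.
    w u : Carrier → Carrier
    w x = ifZero x 1# x
    u x = ifZero x 1# a

    w≉0 : ∀ x → w x ≉ 0#
    w≉0 x with x ≟ 0#
    ... | yes x≈0 = λ w≈0 → 0≉1 (trans (sym w≈0) (reflexive (ifZero-≈0 1# x x≈0)))
    ... | no  x≉0 = λ w≈0 → x≉0 (trans (reflexive (≡.sym (ifZero-≉0 1# x x≉0))) w≈0)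

    w-scale : ∀ {x y} → y ≈ a * x → w y ≈ u x * w x
    w-scale {x} {y} y≈ax with x ≟ 0#
    ... | yes x≈0 = begin
      w y        ≡⟨ ifZero-≈0 1# y (trans y≈ax (trans (*-congˡ x≈0) (zeroʳ a))) ⟩
      1#         ≈⟨ *-identityˡ 1# ⟨
      1# * 1#    ≡⟨ ≡.cong₂ _*_ (ifZero-≈0 1# a x≈0) (ifZero-≈0 1# x x≈0) ⟨
      u x * w x  ∎
    ... | no  x≉0 = begin
      w y        ≡⟨ ifZero-≉0 1# y (λ y≈0 → *-≉0 a≉0 x≉0 (trans (sym y≈ax) y≈0)) ⟩
      y          ≈⟨ y≈ax ⟩
      a * x      ≡⟨ ≡.cong₂ _*_ (ifZero-≉0 1# a x≉0) (ifZero-≉0 1# x x≉0) ⟨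
      u x * w x  ∎

    scaling : Permutation card card
    scaling = carrierPermutation (a *_) (a ⁻¹ *_) *-congˡ *-congˡ (x*[x⁻¹*y]≈y a≉0) (x⁻¹*[x*y]≈y a≉0)

    Πu≈a^[card-1] : Π.sum (u ∘ enum) ≈ a ^ᶠ (card ∸ 1)
    Πu≈a^[card-1] = prod-all-but-one (index 0#) a (u ∘ enum) u-at-0 u-elsewhere
      where
      u-at-0 : u (enum (index 0#)) ≈ 1#
      u-at-0 = reflexive (ifZero-≈0 1# a (enum-index 0#))
      u-elsewhere : ∀ i → i ≢ index 0# → u (enum i) ≈ a
      u-elsewhere i i≢0 = reflexive (ifZero-≉0 1# a
        (λ eᵢ≈0 → i≢0 (enum-inj _ _ (trans eᵢ≈0 (sym (enum-index 0#))))))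

  x^card≈x : ∀ x → x ^ᶠ card ≈ x
  x^card≈x x with x ≟ 0#
  ... | yes x≈0 = begin
    x ^ᶠ card             ≡⟨ ≡.cong (x ^ᶠ_) (ℕₚ.suc-pred card) ⟨
    x * x ^ᶠ (card ∸ 1)   ≈⟨ *-congʳ x≈0 ⟩
    0# * x ^ᶠ (card ∸ 1)  ≈⟨ zeroˡ _ ⟩
    0#                    ≈⟨ x≈0 ⟨
    x                     ∎
  ... | no  x≉0 = begin
    x ^ᶠ card             ≡⟨ ≡.cong (x ^ᶠ_) (ℕₚ.suc-pred card) ⟨
    x * x ^ᶠ (card ∸ 1)   ≈⟨ *-congˡ (fermat x≉0) ⟩
    x * 1#                ≈⟨ *-identityʳ x ⟩
    x                     ∎

  x^card^m≈x : ∀ m x → x ^ᶠ (card N.^ m) ≈ x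
  x^card^m≈x zero    x = *-identityʳ x
  x^card^m≈x (suc m) x = begin
    x ^ᶠ (card N.* card N.^ m)   ≈⟨ ^ᶠ-assocʳ x card (card N.^ m) ⟨
    (x ^ᶠ card) ^ᶠ (card N.^ m)  ≈⟨ ^ᶠ-congˡ (card N.^ m) (x^card≈x x) ⟩
    x ^ᶠ (card N.^ m)            ≈⟨ x^card^m≈x m x ⟩
    x                            ∎

  frobInv-inverse : .{{_ : NonZero n}} → ∀ j z → frobInv j z ^ᶠ (3 N.^ j) ≈ z
  frobInv-inverse j z = begin
    (z ^ᶠ (3 N.^ (n N.* j ∸ j))) ^ᶠ (3 N.^ j)  ≈⟨ ^ᶠ-assocʳ z (3 N.^ (n N.* j ∸ j)) (3 N.^ j) ⟩
    z ^ᶠ (3 N.^ (n N.* j ∸ j) N.* 3 N.^ j)    ≡⟨ ≡.cong (z ^ᶠ_) (ℕₚ.^-distribˡ-+-* 3 (n N.* j ∸ j) j) ⟨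
    z ^ᶠ (3 N.^ (n N.* j ∸ j N.+ j))          ≡⟨ ≡.cong (λ e → z ^ᶠ (3 N.^ e)) (ℕₚ.m∸n+n≡m (ℕₚ.m≤n*m j n)) ⟩
    z ^ᶠ (3 N.^ (n N.* j))                    ≡⟨ ≡.cong (z ^ᶠ_) (ℕₚ.^-*-assoc 3 n j) ⟨
    z ^ᶠ (card N.^ j)                         ≈⟨ x^card^m≈x j z ⟩
    z                                         ∎

  Poly : Set
  Poly = List Carrier

  eval : Poly → Carrier → Carrier
  eval []      x = 0#
  eval (a ∷ p) x = a + x * eval p x

  eval-≈0 : ∀ {p} x → All (_≈ 0#) p → eval p x ≈ 0#
  eval-≈0 x []          = refl
  eval-≈0 x (a≈0 ∷ p≈0) = trans (+-cong a≈0 (trans (*-congˡ (eval-≈0 x p≈0)) (zeroʳ x))) (+-identityʳ 0#)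

  constant≈0 : ∀ {a p} r → All (_≈ 0#) p → eval (a ∷ p) r ≈ 0# → a ≈ 0#
  constant≈0 {a} {p} r p≈0 a+rp≈0 = begin
    a                 ≈⟨ +-identityʳ a ⟨
    a + 0#            ≈⟨ +-congˡ (trans (*-congˡ (eval-≈0 r p≈0)) (zeroʳ r)) ⟨
    a + r * eval p r  ≈⟨ a+rp≈0 ⟩
    0#                ∎

  synthDiv : Carrier → Poly → Poly
  synthDiv r []      = []
  synthDiv r (b ∷ p) = eval (b ∷ p) r ∷ synthDiv r p

  length-synthDiv : ∀ r p → length (synthDiv r p) ≡ length p
  length-synthDiv r []      = ≡.refl
  length-synthDiv r (b ∷ p) = ≡.cong suc (length-synthDiv r p)

  eval-synthDiv : ∀ r p x → x * eval p x ≈ r * eval p r + (x - r) * eval (synthDiv r p) x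
  eval-synthDiv r []      x = trans (zeroʳ x) (sym (trans (+-cong (zeroʳ r) (zeroʳ (x - r))) (+-identityʳ 0#)))
  eval-synthDiv r (b ∷ p) x = begin
    x * (b + x * A)                                    ≈⟨ *-cong x≈d+r (+-congˡ (eval-synthDiv r p x)) ⟩
    (d + r) * (b + (r * B + d * S))                    ≈⟨ expand d r b B S ⟩
    r * (b + r * B) + d * ((b + r * B) + (d + r) * S)  ≈⟨ +-congˡ (*-congˡ (+-congˡ (*-congʳ x≈d+r))) ⟨
    r * (b + r * B) + d * ((b + r * B) + x * S)        ∎
    where
    A = eval p x
    B = eval p r
    S = eval (synthDiv r p) x
    d = x - r
    x≈d+r : x ≈ d + r
    x≈d+r = sym (trans (+-assoc x (- r) r) (trans (+-congˡ (-‿inverseˡ r)) (+-identityʳ x)))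
    -- Written in terms of d = x - r the identity has no subtraction, so the semiring
    -- solver proves it.
    expand : ∀ d r b B S → (d + r) * (b + (r * B + d * S)) ≈
                           r * (b + r * B) + d * ((b + r * B) + (d + r) * S)
    expand = solve 5 (λ d r b B S → ((d :+ r) :* (b :+ (r :* B :+ d :* S))) :=
                                     (r :* (b :+ r :* B) :+ d :* ((b :+ r :* B) :+ (d :+ r) :* S))) refl
      where open Algebra.Solver.Ring.NaturalCoefficients.Default commutativeSemiring

  synthDiv-≈0 : ∀ r p → All (_≈ 0#) (synthDiv r p) → All (_≈ 0#) p
  synthDiv-≈0 r []      []                = []
  synthDiv-≈0 r (b ∷ p) (p[r]≈0 ∷ quot≈0) = constant≈0 r p≈0 p[r]≈0 ∷ p≈0
    where
    p≈0 : All (_≈ 0#) p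
    p≈0 = synthDiv-≈0 r p quot≈0

  roots⇒zero : ∀ {m} p (xs : Fin m → Carrier) → Injective _≡_ _≈_ xs → length p ≤ m →
               (∀ i → eval p (xs i) ≈ 0#) → All (_≈ 0#) p
  roots⇒zero []      _  _      _           _     = []
  roots⇒zero {suc m} (a ∷ p) xs xs-inj (N.s≤s len) roots = constant≈0 r p≈0 (roots Fin.zero) ∷ p≈0
    where
    r = xs Fin.zero
    quotient-roots : ∀ i → eval (synthDiv r p) (xs (Fin.suc i)) ≈ 0#
    quotient-roots i = *-cancelˡ x-r≉0 (∙-cancelˡ (r * eval p r) _ _ (begin
      r * eval p r + (x - r) * eval (synthDiv r p) x  ≈⟨ eval-synthDiv r p x ⟨
      x * eval p x                                     ≈⟨ ∙-cancelˡ a _ _ (trans (roots (Fin.suc i)) (sym (roots Fin.zero))) ⟩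
      r * eval p r                                     ≈⟨ +-identityʳ _ ⟨
      r * eval p r + 0#                                ≈⟨ +-congˡ (zeroʳ (x - r)) ⟨
      r * eval p r + (x - r) * 0#                      ∎))
      where
      x = xs (Fin.suc i)
      x-r≉0 : x - r ≉ 0#
      x-r≉0 x-r≈0 with xs-inj (x∙y⁻¹≈ε⇒x≈y x r x-r≈0)
      ... | ()
    p≈0 : All (_≈ 0#) p
    p≈0 = synthDiv-≈0 r p (roots⇒zero (synthDiv r p) (xs ∘ Fin.suc) (Finₚ.suc-injective ∘ xs-inj)
            (≡.subst (_≤ m) (≡.sym (length-synthDiv r p)) len) quotient-roots)

  vanishing⇒zero : ∀ p → length p ≤ card → (∀ x → eval p x ≈ 0#) → All (_≈ 0#) p
  vanishing⇒zero p len vanishes = roots⇒zero p enum (enum-inj _ _) len (vanishes ∘ enum)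

  addMonomial : ℕ → Poly → Poly
  addMonomial zero    []      = 1# ∷ []
  addMonomial zero    (a ∷ p) = a + 1# ∷ p
  addMonomial (suc e) []      = 0# ∷ addMonomial e []
  addMonomial (suc e) (a ∷ p) = a ∷ addMonomial e p

  eval-addMonomial : ∀ e p x → eval (addMonomial e p) x ≈ eval p x + x ^ᶠ e
  eval-addMonomial zero    []      x = trans (+-congˡ (zeroʳ x)) (+-comm 1# 0#)
  eval-addMonomial zero    (a ∷ p) x =
    trans (+-assoc a 1# _) (trans (+-congˡ (+-comm 1# _)) (sym (+-assoc a _ 1#)))
  eval-addMonomial (suc e) []      x =
    +-congˡ (*-congˡ (trans (eval-addMonomial e [] x) (+-identityˡ _)))
  eval-addMonomial (suc e) (a ∷ p) x = begin
    a + x * eval (addMonomial e p) x  ≈⟨ +-congˡ (*-congˡ (eval-addMonomial e p x)) ⟩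
    a + x * (eval p x + x ^ᶠ e)       ≈⟨ +-congˡ (distribˡ x _ _) ⟩
    a + (x * eval p x + x * x ^ᶠ e)   ≈⟨ +-assoc a _ _ ⟨
    a + x * eval p x + x ^ᶠ suc e     ∎

  length-addMonomial : ∀ e p → length p ≤ e → length (addMonomial e p) ≡ suc e
  length-addMonomial zero    []      _           = ≡.refl
  length-addMonomial (suc e) []      _           = ≡.cong suc (length-addMonomial e [] N.z≤n)
  length-addMonomial (suc e) (a ∷ p) (N.s≤s len) = ≡.cong suc (length-addMonomial e p len)

  addMonomial-≉0 : ∀ e p → length p ≤ e → ¬ All (_≈ 0#) (addMonomial e p)
  addMonomial-≉0 zero    []      _           (1≈0 ∷ _) = 0≉1 (sym 1≈0)
  addMonomial-≉0 (suc e) []      _           (_ ∷ ≈0)  = addMonomial-≉0 e [] N.z≤n ≈0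
  addMonomial-≉0 (suc e) (a ∷ p) (N.s≤s len) (_ ∷ ≈0)  = addMonomial-≉0 e p len ≈0

  powerSumPoly : (ℕ → ℕ) → ℕ → Poly
  powerSumPoly e zero    = []
  powerSumPoly e (suc m) = addMonomial (e m) (powerSumPoly e m)

  eval-powerSumPoly : ∀ e m x → eval (powerSumPoly e m) x ≈ sumTo m (λ i → x ^ᶠ e i)
  eval-powerSumPoly e zero    x = refl
  eval-powerSumPoly e (suc m) x = trans (eval-addMonomial (e m) _ x) (+-congʳ (eval-powerSumPoly e m x))

  length-powerSumPoly : ∀ {e} → (∀ i → e i < e (suc i)) → ∀ m → length (powerSumPoly e m) ≤ e m
  length-powerSumPoly e-inc zero    = N.z≤n
  length-powerSumPoly e-inc (suc m) =
    ℕₚ.≤-trans (ℕₚ.≤-reflexive (length-addMonomial _ _ (length-powerSumPoly e-inc m))) (e-inc m)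

  powerSum-nonvanishing : ∀ {e} → (∀ i → e i < e (suc i)) → ∀ m → e m < card →
                          ¬ (∀ x → sumTo (suc m) (λ i → x ^ᶠ e i) ≈ 0#)
  powerSum-nonvanishing {e} e-inc m eₘ<card vanishes = addMonomial-≉0 (e m) _ len≤eₘ
    (vanishing⇒zero (powerSumPoly e (suc m))
      (ℕₚ.≤-trans (ℕₚ.≤-reflexive (length-addMonomial (e m) _ len≤eₘ)) eₘ<card)
      (λ x → trans (eval-powerSumPoly e (suc m) x) (vanishes x)))
    where
    len≤eₘ = length-powerSumPoly e-inc m

  sumTo-cong : ∀ m {f g : ℕ → Carrier} → (∀ i → f i ≈ g i) → sumTo m f ≈ sumTo m g
  sumTo-cong zero    f≈g = refl
  sumTo-cong (suc m) f≈g = +-cong (sumTo-cong m f≈g) (f≈g m)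

  Tr-cong : ∀ {x y} → x ≈ y → Tr x ≈ Tr y
  Tr-cong x≈y = sumTo-cong (n N./ 1) (λ i → ^ᶠ-congˡ (3 N.^ (i N.* 1)) x≈y)

  Tr-nonvanishing : .{{_ : NonZero n}} → ¬ (∀ x → Tr x ≈ 0#)
  Tr-nonvanishing vanishes = powerSum-nonvanishing 3^i-increasing (N.pred n) 3^[n-1]<card
    (λ x → trans (reflexive (≡.cong (λ m → sumTo m (λ i → x ^ᶠ (3 N.^ (i N.* 1)))) (≡.sym n/1≡1+[n-1])))
                 (vanishes x))
    where
    3^i-increasing : ∀ i → 3 N.^ (i N.* 1) < 3 N.^ (suc i N.* 1)
    3^i-increasing i = ℕₚ.^-monoʳ-< 3 (N.s≤s (N.s≤s N.z≤n)) (ℕₚ.n<1+n (i N.* 1))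
    3^[n-1]<card : 3 N.^ (N.pred n N.* 1) < card
    3^[n-1]<card = ℕₚ.^-monoʳ-< 3 (N.s≤s (N.s≤s N.z≤n))
      (≡.subst₂ _<_ (≡.sym (ℕₚ.*-identityʳ (N.pred n))) (ℕₚ.suc-pred n) (ℕₚ.n<1+n (N.pred n)))
    n/1≡1+[n-1] : n N./ 1 ≡ suc (N.pred n)
    n/1≡1+[n-1] = ≡.trans (n/1≡n n) (≡.sym (ℕₚ.suc-pred n))

  Tr[a*_]≈0⇒a≈0 : .{{_ : NonZero n}} → ∀ {a} → (∀ d → Tr (a * d) ≈ 0#) → a ≈ 0#
  Tr[a*_]≈0⇒a≈0 {a} vanishes = ≈-stable λ a≉0 →
    Tr-nonvanishing (λ x → trans (Tr-cong (sym (x*[x⁻¹*y]≈y a≉0 x))) (vanishes (a ⁻¹ * x)))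

  module PrimitiveElement {e ζ} (ζ-primitive : IsPrimitiveSub e ζ)
                          {d} .{{_ : NonZero d}} (3^e≡1+d : 3 N.^ e ≡ suc d) where

    ζ≉0 : ζ ≉ 0#
    ζ≉0 = proj₁ (proj₂ ζ-primitive)

    ζ^d≈1 : ζ ^ᶠ d ≈ 1#
    ζ^d≈1 = *-cancelˡ ζ≉0 (begin
      ζ * ζ ^ᶠ d    ≈⟨ ^ᶠ-congʳ ζ 3^e≡1+d ⟨
      ζ ^ᶠ 3 N.^ e  ≈⟨ proj₁ ζ-primitive ⟩
      ζ             ≈⟨ *-identityʳ ζ ⟨
      ζ * 1#        ∎)

    ζ^m≉1 : ∀ m → 1 ≤ m → m < d → ζ ^ᶠ m ≉ 1#
    ζ^m≉1 m 1≤m m<d = proj₂ (proj₂ ζ-primitive) m 1≤m (≡.subst (m <_) (≡.cong (_∸ 1) (≡.sym 3^e≡1+d)) m<d)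

    ζ^m≈1⇒d∣m : ∀ m → ζ ^ᶠ m ≈ 1# → d ∣ m
    ζ^m≈1⇒d∣m = pow≈1⇒order∣ ζ^d≈1 ζ^m≉1

    ζ^half≈-1 : ∀ h → h N.+ h ≡ d → ζ ^ᶠ h ≈ - 1#
    ζ^half≈-1 zero    0≡d   = contradiction (≡.sym 0≡d) (N.≢-nonZero⁻¹ d)
    ζ^half≈-1 (suc h) h+h≡d = x*x≈1⇒x≈-1
      (trans (sym (^ᶠ-homo-* ζ (suc h) (suc h))) (trans (^ᶠ-congʳ ζ h+h≡d) ζ^d≈1))
      (ζ^m≉1 (suc h) (N.s≤s N.z≤n) (≡.subst (suc h <_) h+h≡d (ℕₚ.m<m+n (suc h) (N.s≤s N.z≤n))))

  power-equation : ∀ {x y} u v P → x ≉ 0# → y ≉ 0# →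
                   x ^ᶠ suc u * y ^ᶠ suc v ≈ - (x * y) → (card ∸ 1) ∣ v N.* P →
                   x ^ᶠ (u N.* P) ≈ (- 1#) ^ᶠ P
  power-equation {x} {y} u v P x≉0 y≉0 eq (divides w vP≡w[card-1]) = begin
    x ^ᶠ (u N.* P)                   ≈⟨ *-identityʳ _ ⟨
    x ^ᶠ (u N.* P) * 1#              ≈⟨ *-congˡ y^vP≈1 ⟨
    x ^ᶠ (u N.* P) * y ^ᶠ (v N.* P)  ≈⟨ *-cong (^ᶠ-assocʳ x u P) (^ᶠ-assocʳ y v P) ⟨
    (x ^ᶠ u) ^ᶠ P * (y ^ᶠ v) ^ᶠ P    ≈⟨ ^ᶠ-distrib-* (x ^ᶠ u) (y ^ᶠ v) P ⟨
    (x ^ᶠ u * y ^ᶠ v) ^ᶠ P           ≈⟨ ^ᶠ-congˡ P x^u*y^v≈-1 ⟩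
    (- 1#) ^ᶠ P                      ∎
    where
    y^vP≈1 : y ^ᶠ (v N.* P) ≈ 1#
    y^vP≈1 = begin
      y ^ᶠ (v N.* P)             ≡⟨ ≡.cong (y ^ᶠ_) (≡.trans vP≡w[card-1] (ℕₚ.*-comm w (card ∸ 1))) ⟩
      y ^ᶠ ((card ∸ 1) N.* w)    ≈⟨ ^ᶠ-assocʳ y (card ∸ 1) w ⟨
      (y ^ᶠ (card ∸ 1)) ^ᶠ w     ≈⟨ ^ᶠ-congˡ w (fermat y≉0) ⟩
      1# ^ᶠ w                    ≈⟨ 1^ᶠ w ⟩
      1#                         ∎
    x^u*y^v≈-1 : x ^ᶠ u * y ^ᶠ v ≈ - 1#
    x^u*y^v≈-1 = *-cancelˡ (*-≉0 x≉0 y≉0) (begin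
      (x * y) * (x ^ᶠ u * y ^ᶠ v)  ≈⟨ interchange x y (x ^ᶠ u) (y ^ᶠ v) ⟩
      x ^ᶠ suc u * y ^ᶠ suc v      ≈⟨ eq ⟩
      - (x * y)                    ≈⟨ -1*x≈-x (x * y) ⟨
      - 1# * (x * y)               ≈⟨ *-comm (- 1#) (x * y) ⟩
      (x * y) * - 1#               ∎)

  twisted≈0⇒ : .{{_ : NonZero n}} → ∀ j b c →
               b * c ^ᶠ (3 N.^ j) + frobInv j b * frobInv j c ≈ 0# →
               b ^ᶠ (3 N.^ j) * c ^ᶠ (3 N.^ j N.* 3 N.^ j) ≈ - (b * c)
  twisted≈0⇒ j b c twisted≈0 = begin
    b ^ᶠ q * c ^ᶠ (q N.* q)         ≈⟨ *-congˡ (^ᶠ-assocʳ c q q) ⟨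
    b ^ᶠ q * (c ^ᶠ q) ^ᶠ q          ≈⟨ ^ᶠ-distrib-* b (c ^ᶠ q) q ⟨
    (b * c ^ᶠ q) ^ᶠ q               ≈⟨ ^ᶠ-congˡ q (x+y≈0⇒x≈-y twisted≈0) ⟩
    (- (b′ * c′)) ^ᶠ q              ≈⟨ ^ᶠ-congˡ q (-1*x≈-x (b′ * c′)) ⟨
    (- 1# * (b′ * c′)) ^ᶠ q         ≈⟨ ^ᶠ-distrib-* (- 1#) (b′ * c′) q ⟩
    (- 1#) ^ᶠ q * (b′ * c′) ^ᶠ q    ≈⟨ *-cong (-1^odd (3^-odd j)) (^ᶠ-distrib-* b′ c′ q) ⟩
    - 1# * (b′ ^ᶠ q * c′ ^ᶠ q)      ≈⟨ *-congˡ (*-cong (frobInv-inverse j b) (frobInv-inverse j c)) ⟩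
    - 1# * (b * c)                  ≈⟨ -1*x≈-x (b * c) ⟩
    - (b * c)                       ∎
    where
    q  = 3 N.^ j
    b′ = frobInv j b
    c′ = frobInv j c

module QuarticExtension (k : ℕ) .{{_ : NonZero k}} (F : GF3 (4 N.* k)) where
  open GF3 F hiding (zero)
  open Ops F
  open FiniteField F
  open import Relation.Binary.Reasoning.Setoid setoid

  instance
    4k≢0 : NonZero (4 N.* k)
    4k≢0 = ℕₚ.m*n≢0 4 k

  module Order {ζ} (ζ-primitive : IsPrimitiveSub (2 N.* k) ζ)
               (g : ℕ) (3^2k≡1+8g : 3 N.^ (2 N.* k) ≡ 1 N.+ 8 N.* g) where

    instance
      g≢0 : NonZero g
      g≢0 = N.≢-nonZero λ { ≡.refl → ℕₚ.<-irrefl (≡.sym 3^2k≡1+8g) 1<3^2k }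
        where
        1<3^2k : 1 < 3 N.^ (2 N.* k)
        1<3^2k = ℕₚ.^-monoʳ-< 3 (N.s≤s (N.s≤s N.z≤n)) (N.>-nonZero⁻¹ (2 N.* k) {{ℕₚ.m*n≢0 2 k}})

      8g≢0 : NonZero (8 N.* g)
      8g≢0 = ℕₚ.m*n≢0 8 g

      4g≢0 : NonZero (4 N.* g)
      4g≢0 = ℕₚ.m*n≢0 4 g

    open PrimitiveElement {2 N.* k} ζ-primitive 3^2k≡1+8g using (ζ^m≈1⇒d∣m; ζ^half≈-1)

    card-1≡16g[4g+1] : 3 N.^ (4 N.* k) ∸ 1 ≡ 16 N.* (g N.* (4 N.* g N.+ 1))
    card-1≡16g[4g+1] = ≡.cong (_∸ 1) (≡.trans (≡.cong (3 N.^_) (4k≡2k+2k k))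
      (≡.trans (ℕₚ.^-distribˡ-+-* 3 (2 N.* k) (2 N.* k))
      (≡.trans (≡.cong₂ N._*_ 3^2k≡1+8g 3^2k≡1+8g) (square g))))
      where
      4k≡2k+2k : ∀ k → 4 N.* k ≡ 2 N.* k N.+ 2 N.* k
      4k≡2k+2k = solve-∀
      square : ∀ g → (1 N.+ 8 N.* g) N.* (1 N.+ 8 N.* g) ≡ 1 N.+ 16 N.* (g N.* (4 N.* g N.+ 1))
      square = solve-∀

    ζ^4g≈-1 : ζ ^ᶠ (4 N.* g) ≈ - 1#
    ζ^4g≈-1 = ζ^half≈-1 (4 N.* g) (4g+4g≡8g g)
      where
      4g+4g≡8g : ∀ g → 4 N.* g N.+ 4 N.* g ≡ 8 N.* g
      4g+4g≡8g = solve-∀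

    ζ^[4g*odd]≉1 : ∀ {w} → ¬ 2 ∣ w → ζ ^ᶠ (4 N.* g N.* w) ≉ 1#
    ζ^[4g*odd]≉1 {w} w-odd ζ^≈1 = w-odd (*-cancelˡ-∣ (4 N.* g)
      (≡.subst (_∣ 4 N.* g N.* w) (8g≡4g*2 g) (ζ^m≈1⇒d∣m _ ζ^≈1)))
      where
      8g≡4g*2 : ∀ g → 8 N.* g ≡ 4 N.* g N.* 2
      8g≡4g*2 = solve-∀

  h : ℕ
  h = (3 N.^ k N.+ 1) N./ 2

  module VanishingCoefficient (j : ℕ) (t : ℤ) {ζ} (ζ-primitive : IsPrimitiveSub (2 N.* k) ζ)
                              {b} (b≈ζ^th : b ≈ ζ ^ᶻ (t Z.* + h)) {c} (c≉0 : c ≉ 0#)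
                              (twisted≈0 : b * c ^ᶠ (3 N.^ j) + frobInv j b * frobInv j c ≈ 0#) where

    ζ≉0 : ζ ≉ 0#
    ζ≉0 = proj₁ (proj₂ ζ-primitive)

    b≉0 : b ≉ 0#
    b≉0 b≈0 = ^ᶻ-≉0 (t Z.* + h) ζ≉0 (trans (sym b≈ζ^th) b≈0)

    ζ^[s*u*P]≈-1^P : ∀ u v P → 3 N.^ j ≡ suc u → 3 N.^ j N.* 3 N.^ j ≡ suc v →
                     (3 N.^ (4 N.* k) ∸ 1) ∣ v N.* P →
                     ζ ^ᶠ (Z.∣ t ∣ N.* h N.* (u N.* P)) ≈ (- 1#) ^ᶠ P
    ζ^[s*u*P]≈-1^P u v P q≡1+u q²≡1+v card-1∣vP = ^ᶻ-to-^ᶠ-≈ε t h (u N.* P) ζ≉0 (-1^m*-1^m≈1 P)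
      (trans (^ᶠ-congˡ (u N.* P) (sym b≈ζ^th)) (power-equation u v P b≉0 c≉0 b^q*c^q²≈-bc card-1∣vP))
      where
      b^q*c^q²≈-bc : b ^ᶠ suc u * c ^ᶠ suc v ≈ - (b * c)
      b^q*c^q²≈-bc = trans (*-cong (^ᶠ-congʳ b (≡.sym q≡1+u)) (^ᶠ-congʳ c (≡.sym q²≡1+v)))
                           (twisted≈0⇒ j b c twisted≈0)

    k-even-impossible : 2 ∣ k → ¬ 2 ∣ j → ¬ 2 ∣ Z.∣ t ∣ → ⊥
    k-even-impossible (divides κ k≡κ*2) j-odd t-odd with odd⇒≡1+2* j-odd
    ... | ι , j≡1+2ι with 3^[2m]≡1+8* k | 3^[2m]≡1+8* κ | 3^[2m]≡1+8* ι | 3^[2m]≡1+8* j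
    ... | g , 3^2k≡1+8g | x , 3^2κ≡1+8x | y , 3^2ι≡1+8y | w , 3^2j≡1+8w =
      ζ^[4g*odd]≉1 cofactor-odd (begin
        ζ ^ᶠ (4 N.* g N.* cofactor)  ≡⟨ ≡.cong (ζ ^ᶠ_) (exponent s y g) ⟩
        ζ ^ᶠ (s N.* (u N.* P))       ≈⟨ ζ^[s*u*P]≈-1^P u v P q≡1+u q²≡1+v card-1∣vP ⟩
        (- 1#) ^ᶠ P                  ≈⟨ -1^even (m∣m*n (g N.* (4 N.* g N.+ 1))) ⟩
        1#                           ∎)
      where
      open Order ζ-primitive g 3^2k≡1+8g
      s u v P cofactor : ℕ
      s = Z.∣ t ∣ N.* h
      u = 2 N.* (1 N.+ 2 N.* (6 N.* y))
      v = 8 N.* w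
      P = 2 N.* (g N.* (4 N.* g N.+ 1))
      cofactor = s N.* (1 N.+ 2 N.* (6 N.* y)) N.* (1 N.+ 2 N.* (2 N.* g))

      h-odd : ¬ 2 ∣ h
      h-odd = ≡.subst (λ m → ¬ 2 ∣ m)
        (≡.sym ([3^k+1]/2≡odd {k} {x} (≡.trans (≡.cong (3 N.^_) (≡.trans k≡κ*2 (ℕₚ.*-comm κ 2))) 3^2κ≡1+8x)))
        (1+2*-odd (2 N.* x))
      cofactor-odd : ¬ 2 ∣ cofactor
      cofactor-odd = odd*odd (odd*odd (odd*odd t-odd h-odd) (1+2*-odd (6 N.* y))) (1+2*-odd (2 N.* g))

      q≡1+u : 3 N.^ j ≡ suc u
      q≡1+u = ≡.trans (≡.cong (3 N.^_) j≡1+2ι) (≡.trans (≡.cong (3 N.*_) 3^2ι≡1+8y) (triple y))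
        where
        triple : ∀ y → 3 N.* (1 N.+ 8 N.* y) ≡ 1 N.+ 2 N.* (1 N.+ 2 N.* (6 N.* y))
        triple = solve-∀
      q²≡1+v : 3 N.^ j N.* 3 N.^ j ≡ suc v
      q²≡1+v = ≡.trans (3^j*3^j≡3^[2j] j) 3^2j≡1+8w
      card-1∣vP : (3 N.^ (4 N.* k) ∸ 1) ∣ v N.* P
      card-1∣vP = divides w (≡.trans (v*P w g) (≡.cong (w N.*_) (≡.sym card-1≡16g[4g+1])))
        where
        v*P : ∀ w g → 8 N.* w N.* (2 N.* (g N.* (4 N.* g N.+ 1))) ≡ w N.* (16 N.* (g N.* (4 N.* g N.+ 1)))
        v*P = solve-∀
      exponent : ∀ s y g → 4 N.* g N.* (s N.* (1 N.+ 2 N.* (6 N.* y)) N.* (1 N.+ 2 N.* (2 N.* g)))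
                         ≡ s N.* (2 N.* (1 N.+ 2 N.* (6 N.* y)) N.* (2 N.* (g N.* (4 N.* g N.+ 1))))
      exponent = solve-∀

    k-odd-impossible : ¬ 2 ∣ k → 2 ∣ j → ⊥
    k-odd-impossible k-odd (divides ι j≡ι*2) with odd⇒≡1+2* k-odd
    ... | κ , k≡1+2κ with 3^[4m]≡1+16* κ | 3^[2m]≡1+8* ι | 3^[4m]≡1+16* ι
    ... | z , 3^4κ≡1+16z | y , 3^2ι≡1+8y | w , 3^4ι≡1+16w =
      ζ^[4g*odd]≉1 (1+2*-odd (s N.* y N.* (4 N.* g N.+ 1))) (begin
        ζ ^ᶠ (4 N.* g N.* (1 N.+ 2 N.* (s N.* y N.* (4 N.* g N.+ 1))))  ≡⟨ ≡.cong (ζ ^ᶠ_) (exponent s y g) ⟩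
        ζ ^ᶠ (s N.* (u N.* P) N.+ 4 N.* g)        ≈⟨ ^ᶠ-homo-* ζ (s N.* (u N.* P)) (4 N.* g) ⟩
        ζ ^ᶠ (s N.* (u N.* P)) * ζ ^ᶠ (4 N.* g)   ≈⟨ *-cong (ζ^[s*u*P]≈-1^P u v P q≡1+u q²≡1+v card-1∣vP) ζ^4g≈-1 ⟩
        (- 1#) ^ᶠ P * - 1#                        ≈⟨ *-congʳ (-1^odd P-odd) ⟩
        - 1# * - 1#                               ≈⟨ -1*-1≈1 ⟩
        1#                                        ∎)
      where
      g : ℕ
      g = 1 N.+ 2 N.* (9 N.* z)
      3^2k≡1+8g : 3 N.^ (2 N.* k) ≡ 1 N.+ 8 N.* g
      3^2k≡1+8g = ≡.trans (≡.cong (3 N.^_) (≡.trans (≡.cong (2 N.*_) k≡1+2κ) (2[1+2κ]≡2+4κ κ)))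
                    (≡.trans (≡.cong (λ m → 3 N.* (3 N.* m)) 3^4κ≡1+16z) (nine z))
        where
        2[1+2κ]≡2+4κ : ∀ κ → 2 N.* (1 N.+ 2 N.* κ) ≡ 2 N.+ 4 N.* κ
        2[1+2κ]≡2+4κ = solve-∀
        nine : ∀ z → 3 N.* (3 N.* (1 N.+ 16 N.* z)) ≡ 1 N.+ 8 N.* (1 N.+ 2 N.* (9 N.* z))
        nine = solve-∀
      open Order ζ-primitive g 3^2k≡1+8g
      s u v P : ℕ
      s = Z.∣ t ∣ N.* h
      u = 8 N.* y
      v = 16 N.* w
      P = g N.* (1 N.+ 2 N.* (2 N.* g))

      P-odd : ¬ 2 ∣ P
      P-odd = odd*odd (1+2*-odd (9 N.* z)) (1+2*-odd (2 N.* g))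
      q≡1+u : 3 N.^ j ≡ suc u
      q≡1+u = ≡.trans (≡.cong (3 N.^_) (≡.trans j≡ι*2 (ℕₚ.*-comm ι 2))) 3^2ι≡1+8y
      q²≡1+v : 3 N.^ j N.* 3 N.^ j ≡ suc v
      q²≡1+v = ≡.trans (3^j*3^j≡3^[2j] j)
                 (≡.trans (≡.cong (λ e → 3 N.^ (2 N.* e)) j≡ι*2) (≡.trans (≡.cong (3 N.^_) (2[ι*2]≡4ι ι)) 3^4ι≡1+16w))
        where
        2[ι*2]≡4ι : ∀ ι → 2 N.* (ι N.* 2) ≡ 4 N.* ι
        2[ι*2]≡4ι = solve-∀
      card-1∣vP : (3 N.^ (4 N.* k) ∸ 1) ∣ v N.* P
      card-1∣vP = divides w (≡.trans (v*P w g) (≡.cong (w N.*_) (≡.sym card-1≡16g[4g+1])))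
        where
        v*P : ∀ w g → 16 N.* w N.* (g N.* (1 N.+ 2 N.* (2 N.* g))) ≡ w N.* (16 N.* (g N.* (4 N.* g N.+ 1)))
        v*P = solve-∀
      exponent : ∀ s y g → 4 N.* g N.* (1 N.+ 2 N.* (s N.* y N.* (4 N.* g N.+ 1)))
                         ≡ s N.* (8 N.* y N.* (g N.* (1 N.+ 2 N.* (2 N.* g)))) N.+ 4 N.* g
      exponent = solve-∀

    impossible : (2 ∣ k → ¬ 2 ∣ j) → (¬ 2 ∣ k → 2 ∣ j) → ¬ 2 ∣ Z.∣ t ∣ → ⊥
    impossible k-even⇒j-odd k-odd⇒j-even t-odd with 2 ∣? k
    ... | yes k-even = k-even-impossible k-even (k-even⇒j-odd k-even) t-odd
    ... | no  k-odd  = k-odd-impossible k-odd (k-odd⇒j-even k-odd)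

lemma2 : (k : ℕ) → .{{_ : NonZero k}} → (F : GF3 (4 N.* k)) →
    let open GF3 F
        open Ops F
    in (j : ℕ) → (2 ∣ k → ¬ (2 ∣ j)) → (¬ (2 ∣ k) → 2 ∣ j) →
       (t : ℤ) → ¬ ((+ 2) ∣ᶻ t) →
       (ζ : Carrier) → IsPrimitiveSub (2 N.* k) ζ →
       (b : Carrier) → b ≈ ζ ^ᶻ (t Z.* (+ ((3 N.^ k N.+ 1) N./ 2))) →
       (c : Carrier) → c ≉ 0# →
       (InSub (2 N.* k) c ⊎ ((¬ InSub k c) × (TrRel k (b * c) ≉ 0#))) →
       ¬ (∀ (d : Carrier) →
            Tr ((b * c ^ᶠ (3 N.^ j) + frobInv j b * frobInv j c) * d) ≈ 0#)
-- The hypothesis on c is not needed: the coefficient of d is nonzero for every c ≠ 0.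
lemma2 k F j k-even⇒j-odd k-odd⇒j-even t t-odd ζ ζ-primitive b b≈ζ^th c c≉0 _ Tr≈0 =
  impossible k-even⇒j-odd k-odd⇒j-even t-odd
  where
  open QuarticExtension k F
  open FiniteField F using (Tr[a*_]≈0⇒a≈0)
  open VanishingCoefficient j t ζ-primitive b≈ζ^th c≉0 (Tr[a*_]≈0⇒a≈0 Tr≈0)
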